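{- Let $\mathsf{L}$ be any one of $\mathbf{PD}$, $\mathsf{InqL}$, $\mathbf{PT}$. For every formula $\phi$ of $\mathsf{L}$, every flat substitution $\sigma$ of $\mathsf{L}$ and every team $X$: $X\models\sigma(\phi)$ if and only if $X_\sigma\models\phi$.
   Context: Fix a countable set $\mathrm{Prop}$ of propositional variables. A valuation is a function $v:\mathrm{Prop}\to\{0,1\}$; a team is a set of valuations. Formulas of $\mathbf{PT}$: $\phi::=p\mid\bot\mid\top\mid {=}(\phi,\dots,\phi,\phi)\mid\neg\phi\mid\phi\wedge\phi\mid\phi\otimes\phi\mid\phi\vee\phi\mid\phi\to\phi$. Team semantics: $X\models p$ iff $v(p)=1$ for all $v\in X$; $X\models\bot$ iff $X=\emptyset$; $X\models\top$ always; $X\models\phi\wedge\psi$ iff both; $X\models\phi\otimes\psi$ iff $X=Y\cup Z$ for some $Y,Z\subseteq X$ with $Y\models\phi$, $Z\models\psi$; $X\models\phi\vee\psi$ iff $X\models\phi$ or $X\models\psi$; $X\models\phi\to\psi$ iff every $Y\subseteq X$ with $Y\models\phi$ satisfies $Y\models\psi$; $X\models\neg\phi$ iff $\{v\}\not\models\phi$ for all $v\in X$; $X\models{=}(\phi_1,\dots,\phi_n,\psi)$ iff $X\models\bigwedge_{i=1}^n(\phi_i\vee\neg\phi_i)\to(\psi\vee\neg\psi)$. A formula $\phi$ is flat if for every team $X$: $X\models\phi$ iff $\{v\}\models\phi$ for all $v\in X$. Formulas of $\mathbf{PD}$: $\phi::=p\mid\bot\mid\top\mid{=}(\alpha_1,\dots,\alpha_k,\beta)\mid\neg\phi\mid\phi\wedge\phi\mid\phi\otimes\phi$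 with $\alpha_i,\beta$ flat $\mathbf{PD}$-formulas, same semantics. Formulas of $\mathsf{InqL}$: built from $p,\bot,\top$ by $\wedge,\vee,\to$, same semantics. A substitution of $\mathsf{L}$ is a map from formulas of $\mathsf{L}$ to formulas of $\mathsf{L}$ commuting with all connectives and atoms; it is flat if $\sigma(p)$ is flat for all $p$. For a valuation $v$ and substitution $\sigma$, $v_\sigma$ is the valuation with $v_\sigma(p)=1$ iff $\{v\}\models\sigma(p)$; for a team $X$, $X_\sigma=\{v_\sigma\mid v\in X\}$. -}

module Defs where

open import Level using (Level; Lift; lift) renaming (zero to lzero; suc to lsuc)
open import Data.Nat using (ℕ)
open import Data.Bool using (Bool; true; false)
open import Data.List using (List; []; _∷_)
open import Data.List.Relation.Unary.All using (All)
open import Data.Product using (Σ; _×_; _,_; ∃)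
open import Data.Sum using (_⊎_)
open import Data.Empty using (⊥)
open import Data.Unit using (⊤)
open import Relation.Nullary using (¬_; does)
open import Relation.Binary.PropositionalEquality using (_≡_)
open import Axiom.ExcludedMiddle using (ExcludedMiddle)

Valuation : Set
Valuation = ℕ → Bool

Team : Set₁
Team = Valuation → Set

_≈ᵥ_ : Valuation → Valuation → Set
v ≈ᵥ w = ∀ n → v n ≡ w n

⟦_⟧ : Valuation → Team
⟦ v ⟧ w = w ≈ᵥ v

_⊆_ : Team → Team → Set
Y ⊆ X = ∀ v → Y v → X v

-- Formulas of PT (PD and InqL are fragments, see below).
-- dep φs ψ is the dependence atom =(φ₁,…,φₙ,ψ) with φs = [φ₁,…,φₙ].
data Form : Set where
  var  : ℕ → Form
  bot  : Form
  top  : Form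
  dep  : List Form → Form → Form
  neg  : Form → Form
  _∧_  : Form → Form → Form
  _⊗_  : Form → Form → Form
  _∨_  : Form → Form → Form
  _⇒_  : Form → Form → Form

mutual
  _⊨_ : Team → Form → Set₁
  X ⊨ var p = Lift (lsuc lzero) (∀ v → X v → v p ≡ true)
  X ⊨ bot = Lift (lsuc lzero) (∀ v → X v → ⊥)
  X ⊨ top = Lift (lsuc lzero) ⊤
  -- X ⊨ =(φs,ψ) iff X ⊨ ⋀ᵢ(φᵢ ∨ ¬φᵢ) → (ψ ∨ ¬ψ), unfolded
  X ⊨ dep φs ψ = ∀ (Y : Team) → Y ⊆ X → Determined* Y φs
                   → (Y ⊨ ψ) ⊎ (∀ v → Y v → ¬ (⟦ v ⟧ ⊨ ψ))
  X ⊨ neg φ = ∀ v → X v → ¬ (⟦ v ⟧ ⊨ φ)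
  X ⊨ (φ ∧ ψ) = (X ⊨ φ) × (X ⊨ ψ)
  X ⊨ (φ ⊗ ψ) = Σ Team λ Y → Σ Team λ Z →
                  Y ⊆ X × Z ⊆ X × (∀ v → X v → Y v ⊎ Z v) × (Y ⊨ φ) × (Z ⊨ ψ)
  X ⊨ (φ ∨ ψ) = (X ⊨ φ) ⊎ (X ⊨ ψ)
  X ⊨ (φ ⇒ ψ) = ∀ (Y : Team) → Y ⊆ X → Y ⊨ φ → Y ⊨ ψ

  Determined* : Team → List Form → Set₁
  Determined* Y [] = Lift (lsuc lzero) ⊤
  Determined* Y (φ ∷ φs) = ((Y ⊨ φ) ⊎ (∀ v → Y v → ¬ (⟦ v ⟧ ⊨ φ))) × Determined* Y φs

Flat : Form → Set₁
Flat φ = ∀ (X : Team) → (X ⊨ φ → ∀ v → X v → ⟦ v ⟧ ⊨ φ)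
                      × ((∀ v → X v → ⟦ v ⟧ ⊨ φ) → X ⊨ φ)

data Logic : Set where
  PD InqL PT : Logic

data InPD : Form → Set₁ where
  var  : ∀ p → InPD (var p)
  bot  : InPD bot
  top  : InPD top
  dep  : ∀ {αs β} → All (λ α → InPD α × Flat α) αs → InPD β → Flat β → InPD (dep αs β)
  neg  : ∀ {φ} → InPD φ → InPD (neg φ)
  _∧_  : ∀ {φ ψ} → InPD φ → InPD ψ → InPD (φ ∧ ψ)
  _⊗_  : ∀ {φ ψ} → InPD φ → InPD ψ → InPD (φ ⊗ ψ)

data InInqL : Form → Set₁ where
  var  : ∀ p → InInqL (var p)
  bot  : InInqL bot
  top  : InInqL top
  _∧_  : ∀ {φ ψ} → InInqL φ → InInqL ψ → InInqL (φ ∧ ψ)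
  _∨_  : ∀ {φ ψ} → InInqL φ → InInqL ψ → InInqL (φ ∨ ψ)
  _⇒_  : ∀ {φ ψ} → InInqL φ → InInqL ψ → InInqL (φ ⇒ ψ)

FormulaOf : Logic → Form → Set₁
FormulaOf PD φ = InPD φ
FormulaOf InqL φ = InInqL φ
FormulaOf PT φ = Lift (lsuc lzero) ⊤

Subst : Set
Subst = ℕ → Form

mutual
  subst : Subst → Form → Form
  subst σ (var p) = σ p
  subst σ bot = bot
  subst σ top = top
  subst σ (dep φs ψ) = dep (subst* σ φs) (subst σ ψ)
  subst σ (neg φ) = neg (subst σ φ)
  subst σ (φ ∧ ψ) = subst σ φ ∧ subst σ ψ
  subst σ (φ ⊗ ψ) = subst σ φ ⊗ subst σ ψ
  subst σ (φ ∨ ψ) = subst σ φ ∨ subst σ ψ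
  subst σ (φ ⇒ ψ) = subst σ φ ⇒ subst σ ψ

  subst* : Subst → List Form → List Form
  subst* σ [] = []
  subst* σ (φ ∷ φs) = subst σ φ ∷ subst* σ φs

SubstOf : Logic → Subst → Set₁
SubstOf L σ = ∀ p → FormulaOf L (σ p)

FlatSubst : Subst → Set₁
FlatSubst σ = ∀ p → Flat (σ p)

-- v_σ(p) = 1 iff {v} ⊨ σ(p).  The metatheory is classical: we use an
-- excluded-middle oracle to turn this proposition into a Boolean.
valσ : ExcludedMiddle (lsuc lzero) → Subst → Valuation → Valuation
valσ em σ v p = does (em {⟦ v ⟧ ⊨ σ p})

teamσ : ExcludedMiddle (lsuc lzero) → Subst → Team → Team
teamσ em σ X w = ∃ λ v → X v × (w ≈ᵥ valσ em σ v)

-- Flatness of σ(p) makes X ⊨ σ(p) hold exactly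
-- when every v ∈ X has v_σ(p) = 1, i.e. when X_σ ⊨ p.  The other clauses of the
-- semantics commute with the map X ↦ X_σ because it is monotone, sends {v} to
-- {v_σ}, and every subteam Y' of X_σ is the image of its preimage in X.  Images
-- and preimages only agree up to pointwise equality of valuations, so the
-- induction also needs that satisfaction is invariant under that equivalence.
module Submission where

open import Defs
open import Level using (Level; _⊔_; lift; lower) renaming (zero to lzero; suc to lsuc)
open import Data.Nat using (ℕ)
open import Data.Bool using (Bool; true)
open import Data.List using ([]; _∷_)
open import Data.Product using (Σ; _×_; _,_; ∃; proj₁; proj₂)
open import Data.Product.Function.NonDependent.Propositional using (_×-⇔_)
open import Data.Sum using (_⊎_; inj₁; inj₂; [_,_])
open import Data.Sum.Function.Propositional using (_⊎-⇔_)
open import Data.Empty using (⊥; ⊥-elim)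
open import Function using (_∘_)
open import Function.Bundles using (_⇔_; mk⇔; Equivalence)
open import Function.Construct.Composition using (_⇔-∘_)
open import Function.Construct.Identity using (⇔-id)
open import Function.Construct.Symmetry using (⇔-sym)
open import Function.Related.Propositional using (module EquationalReasoning)
open import Function.Related.TypeIsomorphisms using (→-cong-⇔; ¬-cong-⇔)
open import Relation.Nullary using (yes; no)
open import Relation.Unary using (_∩_)
open import Relation.Binary.Bundles using (Setoid)
open import Relation.Binary.Definitions using (_Respects_)
open import Relation.Binary.PropositionalEquality using (_≡_; refl; sym; trans; _→-setoid_)
open import Axiom.ExcludedMiddle using (ExcludedMiddle)

open Setoid (ℕ →-setoid Bool)
  using () renaming (refl to ≈ᵥ-refl; sym to ≈ᵥ-sym; trans to ≈ᵥ-trans)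

private
  variable
    ℓ ℓ' : Level
    u v : Valuation
    X X' Y Y' Z : Team

closure : Team → Team
closure Y v = ∃ λ w → Y w × v ≈ᵥ w

_⊑_ : Team → Team → Set
X ⊑ Y = X ⊆ closure Y

_≋_ : Team → Team → Set
X ≋ Y = X ⊑ Y × Y ⊑ X

≋-sym : X ≋ Y → Y ≋ X
≋-sym (X⊑Y , Y⊑X) = Y⊑X , X⊑Y

⟦⟧-cong : u ≈ᵥ v → ⟦ u ⟧ ≋ ⟦ v ⟧
⟦⟧-cong u≈v = (λ w w≈u → _ , ≈ᵥ-refl , ≈ᵥ-trans w≈u u≈v)
            , (λ w w≈v → _ , ≈ᵥ-refl , ≈ᵥ-trans w≈v (≈ᵥ-sym u≈v))

∩-closure-≋ : X ≋ X' → Y' ⊆ X' → (X ∩ closure Y') ≋ Y'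
∩-closure-≋ (_ , X'⊑X) Y'⊆X' =
    (λ v → proj₂)
  , λ w yw → let (u , xu , w≈u) = X'⊑X w (Y'⊆X' w yw)
             in u , (xu , w , yw , ≈ᵥ-sym w≈u) , w≈u

AllSubteams : (Team → Set ℓ) → Team → Set (lsuc lzero ⊔ ℓ)
AllSubteams P X = ∀ Y → Y ⊆ X → P Y

Splits : (Team → Set ℓ) → (Team → Set ℓ) → Team → Set (lsuc lzero ⊔ ℓ)
Splits P Q X = Σ Team λ Y → Σ Team λ Z →
  Y ⊆ X × Z ⊆ X × (∀ v → X v → Y v ⊎ Z v) × P Y × Q Z

Invariant : (Team → Set ℓ) → Set (lsuc lzero ⊔ ℓ)
Invariant P = ∀ {Y Y'} → Y ≋ Y' → P Y → P Y'

invariant⇒⇔ : {P : Team → Set ℓ} → Invariant P → X ≋ Y → P X ⇔ P Y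
invariant⇒⇔ P-inv X≋Y = mk⇔ (P-inv X≋Y) (P-inv (≋-sym X≋Y))

module _ {P Q : Team → Set ℓ} where

  ×-invariant : Invariant P → Invariant Q → Invariant (λ X → P X × Q X)
  ×-invariant P-inv Q-inv X≋Y (p , q) = P-inv X≋Y p , Q-inv X≋Y q

  ⊎-invariant : Invariant P → Invariant Q → Invariant (λ X → P X ⊎ Q X)
  ⊎-invariant P-inv Q-inv X≋Y = [ inj₁ ∘ P-inv X≋Y , inj₂ ∘ Q-inv X≋Y ]

  →-invariant : Invariant P → Invariant Q → Invariant (λ X → P X → Q X)
  →-invariant P-inv Q-inv X≋Y f = Q-inv X≋Y ∘ f ∘ P-inv (≋-sym X≋Y)

  Splits-invariant : Invariant P → Invariant Q → Invariant (Splits P Q)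
  Splits-invariant P-inv Q-inv {X} {X'} X≋X' (Y , Z , Y⊆X , Z⊆X , cover , p , q) =
      X' ∩ closure Y , X' ∩ closure Z , (λ v → proj₁) , (λ v → proj₁) , cover'
    , P-inv (≋-sym (∩-closure-≋ (≋-sym X≋X') Y⊆X)) p
    , Q-inv (≋-sym (∩-closure-≋ (≋-sym X≋X') Z⊆X)) q
    where
      cover' : ∀ v → X' v → (X' ∩ closure Y) v ⊎ (X' ∩ closure Z) v
      cover' v x'v with proj₂ X≋X' v x'v
      ... | u , xu , v≈u = [ (λ yu → inj₁ (x'v , u , yu , v≈u))
                           , (λ zu → inj₂ (x'v , u , zu , v≈u)) ] (cover u xu)

AllSubteams-invariant : {P : Team → Set ℓ} → Invariant P → Invariant (AllSubteams P)
AllSubteams-invariant P-inv X≋X' h Y' Y'⊆X' =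
  P-inv (∩-closure-≋ X≋X' Y'⊆X') (h _ λ v → proj₁)

∀∈-invariant : {B : Valuation → Set ℓ} → B Respects _≈ᵥ_ → Invariant (λ X → ∀ v → X v → B v)
∀∈-invariant B-resp (_ , X'⊑X) h v x'v =
  let (u , xu , v≈u) = X'⊑X v x'v in B-resp (≈ᵥ-sym v≈u) (h u xu)

neg-invariant : ∀ {φ} → Invariant (_⊨ φ) → Invariant (_⊨ neg φ)
neg-invariant ⊨φ-inv = ∀∈-invariant λ u≈v ¬u⊨φ → ¬u⊨φ ∘ ⊨φ-inv (⟦⟧-cong (≈ᵥ-sym u≈v))

mutual
  ⊨-invariant : ∀ φ → Invariant (_⊨ φ)
  ⊨-invariant (var p) X≋Y = lift ∘ ∀∈-invariant (λ u≈v → trans (sym (u≈v p))) X≋Y ∘ lower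
  ⊨-invariant bot X≋Y = lift ∘ ∀∈-invariant (λ _ → λ ()) X≋Y ∘ lower
  ⊨-invariant top X≋Y h = h
  ⊨-invariant (dep φs ψ) = AllSubteams-invariant
    (→-invariant (Determined*-invariant φs)
                 (⊎-invariant (⊨-invariant ψ) (neg-invariant (⊨-invariant ψ))))
  ⊨-invariant (neg φ) = neg-invariant (⊨-invariant φ)
  ⊨-invariant (φ ∧ ψ) = ×-invariant (⊨-invariant φ) (⊨-invariant ψ)
  ⊨-invariant (φ ⊗ ψ) = Splits-invariant (⊨-invariant φ) (⊨-invariant ψ)
  ⊨-invariant (φ ∨ ψ) = ⊎-invariant (⊨-invariant φ) (⊨-invariant ψ)
  ⊨-invariant (φ ⇒ ψ) = AllSubteams-invariant (→-invariant (⊨-invariant φ) (⊨-invariant ψ))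

  Determined*-invariant : ∀ φs → Invariant (λ X → Determined* X φs)
  Determined*-invariant [] X≋Y d = d
  Determined*-invariant (φ ∷ φs) = ×-invariant
    (⊎-invariant (⊨-invariant φ) (neg-invariant (⊨-invariant φ)))
    (Determined*-invariant φs)

module _ (em : ExcludedMiddle (lsuc lzero)) (σ : Subst) where

  infix 30 _ˢ
  _ˢ : Valuation → Valuation
  _ˢ = valσ em σ

  image : Team → Team
  image = teamσ em σ

  preimage : Team → Team
  preimage Y' v = closure Y' (v ˢ)

  ˢ-true⇔ : ∀ {p} → (v ˢ) p ≡ true ⇔ ⟦ v ⟧ ⊨ σ p
  ˢ-true⇔ {v} {p} with em {⟦ v ⟧ ⊨ σ p}
  ... | yes v⊨σp = mk⇔ (λ _ → v⊨σp) (λ _ → refl)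
  ... | no  v⊭σp = mk⇔ (λ ()) (⊥-elim ∘ v⊭σp)

  ˢ-cong : u ≈ᵥ v → u ˢ ≈ᵥ v ˢ
  ˢ-cong {u} {v} u≈v p with em {⟦ u ⟧ ⊨ σ p} | em {⟦ v ⟧ ⊨ σ p}
  ... | yes _   | yes _   = refl
  ... | no  _   | no  _   = refl
  ... | yes u⊨σp | no v⊭σp = ⊥-elim (v⊭σp (⊨-invariant (σ p) (⟦⟧-cong u≈v) u⊨σp))
  ... | no u⊭σp | yes v⊨σp = ⊥-elim (u⊭σp (⊨-invariant (σ p) (⟦⟧-cong (≈ᵥ-sym u≈v)) v⊨σp))

  ∈-image : X v → image X (v ˢ)
  ∈-image xv = _ , xv , ≈ᵥ-refl

  image-mono : Y ⊆ X → image Y ⊆ image X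
  image-mono Y⊆X w (v , yv , w≈vˢ) = v , Y⊆X v yv , w≈vˢ

  image-⟦⟧ : image ⟦ v ⟧ ≋ ⟦ v ˢ ⟧
  image-⟦⟧ = (λ w (u , u≈v , w≈uˢ) → _ , ≈ᵥ-refl , ≈ᵥ-trans w≈uˢ (ˢ-cong u≈v))
           , (λ w w≈vˢ → _ , ∈-image ≈ᵥ-refl , w≈vˢ)

  image-preimage : Y' ⊆ image X → image (X ∩ preimage Y') ≋ Y'
  image-preimage Y'⊆X =
      (λ w (v , (xv , u , y'u , vˢ≈u) , w≈vˢ) → u , y'u , ≈ᵥ-trans w≈vˢ vˢ≈u)
    , λ u y'u → let (v , xv , u≈vˢ) = Y'⊆X u y'u
                in v ˢ , (v , (xv , u , y'u , ≈ᵥ-sym u≈vˢ) , ≈ᵥ-refl) , u≈vˢ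

  ∀-image : {A : Valuation → Set ℓ} {B : Valuation → Set ℓ'} → B Respects _≈ᵥ_ →
            (∀ v → A v ⇔ B (v ˢ)) → (∀ v → X v → A v) ⇔ (∀ w → image X w → B w)
  ∀-image B-resp A⇔B = mk⇔
    (λ h w (v , xv , w≈vˢ) → B-resp (≈ᵥ-sym w≈vˢ) (Equivalence.to (A⇔B v) (h v xv)))
    (λ h v xv → Equivalence.from (A⇔B v) (h (v ˢ) (∈-image xv)))

  AllSubteams-image : {P Q : Team → Set ℓ} → Invariant Q → (∀ Y → P Y ⇔ Q (image Y)) →
                      AllSubteams P X ⇔ AllSubteams Q (image X)
  AllSubteams-image {X = X} Q-inv P⇔Q = mk⇔
    (λ h Y' Y'⊆ → Q-inv (image-preimage Y'⊆)
                        (Equivalence.to (P⇔Q _) (h (X ∩ preimage Y') λ v → proj₁)))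
    (λ h Y Y⊆X → Equivalence.from (P⇔Q Y) (h (image Y) (image-mono Y⊆X)))

  Splits-image : {P₁ P₂ Q₁ Q₂ : Team → Set ℓ} → Invariant Q₁ → Invariant Q₂ →
                 (∀ Y → P₁ Y ⇔ Q₁ (image Y)) → (∀ Y → P₂ Y ⇔ Q₂ (image Y)) →
                 Splits P₁ P₂ X ⇔ Splits Q₁ Q₂ (image X)
  Splits-image {X = X} Q₁-inv Q₂-inv P₁⇔Q₁ P₂⇔Q₂ = mk⇔ to from
    where
      to : Splits _ _ X → Splits _ _ (image X)
      to (Y , Z , Y⊆X , Z⊆X , cover , p , q) =
          image Y , image Z , image-mono Y⊆X , image-mono Z⊆X
        , (λ { w (v , xv , w≈vˢ) → [ (λ yv → inj₁ (v , yv , w≈vˢ))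
                                   , (λ zv → inj₂ (v , zv , w≈vˢ)) ] (cover v xv) })
        , Equivalence.to (P₁⇔Q₁ Y) p , Equivalence.to (P₂⇔Q₂ Z) q
      from : Splits _ _ (image X) → Splits _ _ X
      from (Y' , Z' , Y'⊆ , Z'⊆ , cover , q₁ , q₂) =
          X ∩ preimage Y' , X ∩ preimage Z' , (λ v → proj₁) , (λ v → proj₁)
        , (λ v xv → [ (λ y' → inj₁ (xv , v ˢ , y' , ≈ᵥ-refl))
                    , (λ z' → inj₂ (xv , v ˢ , z' , ≈ᵥ-refl)) ] (cover (v ˢ) (∈-image xv)))
        , Equivalence.from (P₁⇔Q₁ _) (Q₁-inv (≋-sym (image-preimage Y'⊆)) q₁)
        , Equivalence.from (P₂⇔Q₂ _) (Q₂-inv (≋-sym (image-preimage Z'⊆)) q₂)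

  neg-image : ∀ {φ ψ} → (∀ v → ⟦ v ⟧ ⊨ ψ ⇔ image ⟦ v ⟧ ⊨ φ) → X ⊨ neg ψ ⇔ image X ⊨ neg φ
  neg-image {φ = φ} ψ⇔φ = ∀-image
    (λ u≈v ¬u⊨φ → ¬u⊨φ ∘ ⊨-invariant φ (⟦⟧-cong (≈ᵥ-sym u≈v)))
    (λ v → ¬-cong-⇔ (invariant⇒⇔ (⊨-invariant φ) image-⟦⟧ ⇔-∘ ψ⇔φ v))

  module _ (flat : FlatSubst σ) where

    flat⇔ : ∀ p → X ⊨ σ p ⇔ (∀ v → X v → ⟦ v ⟧ ⊨ σ p)
    flat⇔ {X} p = mk⇔ (proj₁ (flat p X)) (proj₂ (flat p X))

    mutual
      ⊨-subst⇔ : ∀ φ X → X ⊨ subst σ φ ⇔ image X ⊨ φ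
      ⊨-subst⇔ (var p) X =
        X ⊨ σ p                          ∼⟨ flat⇔ p ⟩
        (∀ v → X v → ⟦ v ⟧ ⊨ σ p)        ∼⟨ ∀-image (λ u≈v → trans (sym (u≈v p))) (λ v → ⇔-sym ˢ-true⇔) ⟩
        (∀ w → image X w → w p ≡ true)  ∼⟨ mk⇔ lift lower ⟩
        image X ⊨ var p                  ∎
        where open EquationalReasoning
      ⊨-subst⇔ bot X =
        X ⊨ bot                     ∼⟨ mk⇔ lower lift ⟩
        (∀ v → X v → ⊥)             ∼⟨ ∀-image (λ _ → λ ()) (λ _ → ⇔-id ⊥) ⟩
        (∀ w → image X w → ⊥)       ∼⟨ mk⇔ lift lower ⟩
        image X ⊨ bot               ∎
        where open EquationalReasoning
      ⊨-subst⇔ top X = ⇔-id _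
      ⊨-subst⇔ (dep φs ψ) X = AllSubteams-image
        (→-invariant (Determined*-invariant φs)
                     (⊎-invariant (⊨-invariant ψ) (neg-invariant (⊨-invariant ψ))))
        (λ Y → →-cong-⇔ (Determined*-subst⇔ φs Y)
                        (⊨-subst⇔ ψ Y ⊎-⇔ neg-image (⊨-subst⇔ ψ ∘ ⟦_⟧)))
      ⊨-subst⇔ (neg φ) X = neg-image (⊨-subst⇔ φ ∘ ⟦_⟧)
      ⊨-subst⇔ (φ ∧ ψ) X = ⊨-subst⇔ φ X ×-⇔ ⊨-subst⇔ ψ X
      ⊨-subst⇔ (φ ⊗ ψ) X = Splits-image (⊨-invariant φ) (⊨-invariant ψ) (⊨-subst⇔ φ) (⊨-subst⇔ ψ)
      ⊨-subst⇔ (φ ∨ ψ) X = ⊨-subst⇔ φ X ⊎-⇔ ⊨-subst⇔ ψ X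
      ⊨-subst⇔ (φ ⇒ ψ) X = AllSubteams-image
        (→-invariant (⊨-invariant φ) (⊨-invariant ψ))
        (λ Y → →-cong-⇔ (⊨-subst⇔ φ Y) (⊨-subst⇔ ψ Y))

      Determined*-subst⇔ : ∀ φs X → Determined* X (subst* σ φs) ⇔ Determined* (image X) φs
      Determined*-subst⇔ [] X = ⇔-id _
      Determined*-subst⇔ (φ ∷ φs) X =
        (⊨-subst⇔ φ X ⊎-⇔ neg-image (⊨-subst⇔ φ ∘ ⟦_⟧)) ×-⇔ Determined*-subst⇔ φs X

-- The theorem holds for every formula of PT and every flat substitution.
lemma3p5 : (em : ExcludedMiddle (lsuc lzero)) (L : Logic) (φ : Form) (σ : Subst)
           → FormulaOf L φ → SubstOf L σ → FlatSubst σ → (X : Team)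
           → ((X ⊨ subst σ φ) → (teamσ em σ X ⊨ φ)) × ((teamσ em σ X ⊨ φ) → (X ⊨ subst σ φ))
lemma3p5 em L φ σ _ _ flat X = to , from
  where open Equivalence (⊨-subst⇔ em σ flat φ X)
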